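{- Let $G$ be a finite simple graph on $n$ vertices with $\alpha(G)\le 2$. If $G$ has no induced subgraph isomorphic to $P_4$, or has no induced subgraph isomorphic to $K_3^e$, then $G$ contains $K_{\lceil n/2\rceil}$ as an immersion.
   Context: $\alpha(G)$ is the independence number. $P_4$ is the path on 4 vertices. $K_3^e$ is the 4-vertex graph consisting of a triangle together with a fourth vertex adjacent to exactly one vertex of the triangle (the "paw"). A graph $G$ contains a graph $K$ as an immersion if there is an injective map $\phi\colon V(K)\to V(G)$ such that for every edge $uv\in E(K)$ there is a path $P_{uv}$ in $G$ with endpoints $\phi(u),\phi(v)$, the paths $P_{uv}$ are pairwise edge-disjoint, and no vertex of $\phi(V(K))$ is an interior vertex of any path $P_{uv}$. -}

module Defs where

open import Data.Nat using (ℕ; ⌈_/2⌉)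
open import Data.Fin using (Fin; zero; suc; _<_)
open import Data.Bool using (Bool; true; false)
open import Data.List using (List; []; _∷_; _++_)
open import Data.List.Membership.Propositional using (_∈_)
open import Data.List.Relation.Unary.Unique.Propositional using (Unique)
open import Data.List.Relation.Unary.Linked using (Linked)
open import Data.Product using (Σ; ∃; ∃₂; _×_; _,_)
open import Data.Sum using (_⊎_)
open import Data.Empty using (⊥)
open import Relation.Nullary using (¬_)
open import Relation.Binary.PropositionalEquality using (_≡_; _≢_)
open import Function.Definitions using (Injective)

record Graph (n : ℕ) : Set where
  field
    adj   : Fin n → Fin n → Bool
    sym   : ∀ u v → adj u v ≡ adj v u
    irrefl : ∀ u → adj u u ≡ false
open Graph public

Adj : ∀ {n} → Graph n → Fin n → Fin n → Set
Adj G u v = adj G u v ≡ true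

IndepNumberAtMost2 : ∀ {n} → Graph n → Set
IndepNumberAtMost2 {n} G =
  (x y z : Fin n) → x ≢ y → x ≢ z → y ≢ z →
  Adj G x y ⊎ Adj G x z ⊎ Adj G y z

HasInducedSubgraph : ∀ {n k} → Graph n → Graph k → Set
HasInducedSubgraph {n} {k} G H =
  Σ (Fin k → Fin n) λ f →
    Injective _≡_ _≡_ f × (∀ i j → adj G (f i) (f j) ≡ adj H i j)

private
  v0 v1 v2 v3 : Fin 4
  v0 = zero
  v1 = suc zero
  v2 = suc (suc zero)
  v3 = suc (suc (suc zero))

p4adj : Fin 4 → Fin 4 → Bool
p4adj zero (suc zero) = true
p4adj (suc zero) zero = true
p4adj (suc zero) (suc (suc zero)) = true
p4adj (suc (suc zero)) (suc zero) = true
p4adj (suc (suc zero)) (suc (suc (suc zero))) = true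
p4adj (suc (suc (suc zero))) (suc (suc zero)) = true
p4adj _ _ = false

P4 : Graph 4
P4 = record { adj = p4adj ; sym = s ; irrefl = r }
  where
  s : ∀ u v → p4adj u v ≡ p4adj v u
  s zero zero = _≡_.refl
  s zero (suc zero) = _≡_.refl
  s zero (suc (suc zero)) = _≡_.refl
  s zero (suc (suc (suc zero))) = _≡_.refl
  s (suc zero) zero = _≡_.refl
  s (suc zero) (suc zero) = _≡_.refl
  s (suc zero) (suc (suc zero)) = _≡_.refl
  s (suc zero) (suc (suc (suc zero))) = _≡_.refl
  s (suc (suc zero)) zero = _≡_.refl
  s (suc (suc zero)) (suc zero) = _≡_.refl
  s (suc (suc zero)) (suc (suc zero)) = _≡_.refl
  s (suc (suc zero)) (suc (suc (suc zero))) = _≡_.refl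
  s (suc (suc (suc zero))) zero = _≡_.refl
  s (suc (suc (suc zero))) (suc zero) = _≡_.refl
  s (suc (suc (suc zero))) (suc (suc zero)) = _≡_.refl
  s (suc (suc (suc zero))) (suc (suc (suc zero))) = _≡_.refl
  r : ∀ u → p4adj u u ≡ false
  r zero = _≡_.refl
  r (suc zero) = _≡_.refl
  r (suc (suc zero)) = _≡_.refl
  r (suc (suc (suc zero))) = _≡_.refl

-- K₃ᵉ (paw): triangle 0,1,2 plus vertex 3 adjacent only to 2.
pawadj : Fin 4 → Fin 4 → Bool
pawadj zero (suc zero) = true
pawadj (suc zero) zero = true
pawadj zero (suc (suc zero)) = true
pawadj (suc (suc zero)) zero = true
pawadj (suc zero) (suc (suc zero)) = true
pawadj (suc (suc zero)) (suc zero) = true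
pawadj (suc (suc zero)) (suc (suc (suc zero))) = true
pawadj (suc (suc (suc zero))) (suc (suc zero)) = true
pawadj _ _ = false

K3e : Graph 4
K3e = record { adj = pawadj ; sym = s ; irrefl = r }
  where
  s : ∀ u v → pawadj u v ≡ pawadj v u
  s zero zero = _≡_.refl
  s zero (suc zero) = _≡_.refl
  s zero (suc (suc zero)) = _≡_.refl
  s zero (suc (suc (suc zero))) = _≡_.refl
  s (suc zero) zero = _≡_.refl
  s (suc zero) (suc zero) = _≡_.refl
  s (suc zero) (suc (suc zero)) = _≡_.refl
  s (suc zero) (suc (suc (suc zero))) = _≡_.refl
  s (suc (suc zero)) zero = _≡_.refl
  s (suc (suc zero)) (suc zero) = _≡_.refl
  s (suc (suc zero)) (suc (suc zero)) = _≡_.refl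
  s (suc (suc zero)) (suc (suc (suc zero))) = _≡_.refl
  s (suc (suc (suc zero))) zero = _≡_.refl
  s (suc (suc (suc zero))) (suc zero) = _≡_.refl
  s (suc (suc (suc zero))) (suc (suc zero)) = _≡_.refl
  s (suc (suc (suc zero))) (suc (suc (suc zero))) = _≡_.refl
  r : ∀ u → pawadj u u ≡ false
  r zero = _≡_.refl
  r (suc zero) = _≡_.refl
  r (suc (suc zero)) = _≡_.refl
  r (suc (suc (suc zero))) = _≡_.refl

fullPath : ∀ {n} → Fin n → List (Fin n) → Fin n → List (Fin n)
fullPath a mid b = a ∷ (mid ++ b ∷ [])

IsPath : ∀ {n} → Graph n → Fin n → List (Fin n) → Fin n → Set
IsPath G a mid b =
  Linked (Adj G) (fullPath a mid b) × Unique (fullPath a mid b)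

UsesEdge : ∀ {n} → Fin n → Fin n → List (Fin n) → Set
UsesEdge u v ps =
  (∃₂ λ xs ys → ps ≡ xs ++ u ∷ v ∷ ys) ⊎ (∃₂ λ xs ys → ps ≡ xs ++ v ∷ u ∷ ys)

-- G contains K_m as an immersion.  The edges of K_m are the pairs
-- (i , j) with i < j; P i j is the interior of the path P_{ij}
-- (only meaningful for i < j).
ImmersesComplete : ∀ {n} → Graph n → ℕ → Set
ImmersesComplete {n} G m =
  Σ (Fin m → Fin n) λ φ →
  Σ (Fin m → Fin m → List (Fin n)) λ P →
    Injective _≡_ _≡_ φ
    × (∀ i j → i < j → IsPath G (φ i) (P i j) (φ j))
    × (∀ i j → i < j → ∀ x → x ∈ P i j → ∀ k → x ≢ φ k)
    × (∀ i j k l → i < j → k < l → ¬ (i ≡ k × j ≡ l) →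
         ∀ u v → UsesEdge u v (fullPath (φ i) (P i j) (φ j)) →
                 ¬ UsesEdge u v (fullPath (φ k) (P k l) (φ l)))

module Submission where

-- With α(G) ≤ 2 there is a clique on at least half of the vertices, and a clique on m vertices
-- immerses K_m with one-edge paths.  Take a vertex v.  If v is adjacent to all other vertices,
-- recurse on the rest.  Otherwise pick a non-neighbour w; every vertex besides v, w is adjacent to v
-- only (B), to w only (C) or to both (D), and α(G) ≤ 2 makes v ∪ B and w ∪ C cliques.
-- Recursion on D gives a clique K ⊆ D with |D| ≤ 2|K|.  Without an induced P4, K is complete to
-- B ∪ C, and K together with the larger of v ∪ B, w ∪ C is large enough.  Without an induced paw,
-- |D| ≥ 2 forces B = C = ∅ (then take v ∪ K), and |D| ≤ 1 leaves a large enough clique unless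
-- G is the five-cycle, which immerses K_3.  Immersions are transported along subgraph embeddings,
-- so only K_m in the complete graph and K_3 in the five-cycle (by evaluation) need to be built.

open import Defs hiding (sym)
open import Data.Nat using (ℕ; ⌈_/2⌉)
open import Data.Sum using (_⊎_)
open import Relation.Nullary using (¬_)

open import Data.Bool using (Bool; true; false; not; _∨_)
open import Data.Bool.Properties using (¬-not) renaming (_≟_ to _≟ᵇ_)
open import Data.Empty using (⊥-elim)
open import Data.Fin using (Fin; zero; suc; _≟_; _<?_; inject≤) renaming (_<_ to _<ᶠ_)
open import Data.Fin.Properties using (all?; <-cmp; <-asym; <⇒≢; inject≤-injective)
open import Data.List
  using (List; []; _∷_; _++_; length; map; lookup; filter; cartesianProduct; allFin)
open import Data.List.Membership.Propositional using (_∈_; find)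
open import Data.List.Membership.Propositional.Properties
  using (∈-map⁻; ∈-lookup; ∈-filter⁺; ∈-filter⁻; ∈-cartesianProduct⁺; ∈-allFin)
open import Data.List.Properties
  using (∷-injectiveʳ; map-++; length-++; length-filter; length-tabulate)
open import Data.List.Relation.Unary.All as All using (All; []; _∷_)
import Data.List.Relation.Unary.All.Properties as All
open import Data.List.Relation.Unary.AllPairs as AllPairs using (AllPairs; []; _∷_)
import Data.List.Relation.Unary.AllPairs.Properties as AllPairs
open import Data.List.Relation.Unary.Any using (here; there)
open import Data.List.Relation.Unary.Linked as Linked using ([-]; _∷_; linked?)
import Data.List.Relation.Unary.Linked.Properties as Linked
open import Data.List.Relation.Unary.Unique.Propositional using (Unique)
import Data.List.Relation.Unary.Unique.Propositional.Properties as Unique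
open import Data.Nat using (_≤_; _<_; _+_; suc; z≤n; s≤s; _≤?_)
open import Data.Nat.Induction using (<-wellFounded)
open import Data.Nat.Properties
  using ( ≤-refl; ≤-trans; ≤-reflexive; ≤-antisym; ≰⇒≥; ≰⇒>; +-suc; +-identityʳ; m≤n+m; n≤1+n
        ; +-mono-≤; +-monoˡ-≤; +-monoʳ-≤; ⌈n/2⌉-mono; n≡⌈n+n/2⌉; module ≤-Reasoning)
open import Data.Nat.Tactic.RingSolver using (solve-∀)
open import Data.Product using (Σ; ∃₂; _×_; _,_; proj₁; proj₂; uncurry)
open import Data.Sum using (inj₁; inj₂)
open import Data.Vec as Vec using ([]; _∷_)
open import Function using (_∘_; id)
open import Function.Definitions using (Injective)
open import Induction.WellFounded using (Acc; acc)
open import Relation.Binary using (tri<; tri≈; tri>)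
open import Relation.Binary.Definitions using (DecidableEquality)
open import Relation.Binary.PropositionalEquality
  using (_≡_; _≢_; refl; sym; trans; cong; cong₂; subst)
open import Relation.Nullary using (Dec; yes; no; does; ¬?)
open import Relation.Nullary.Decidable using (from-yes; _×-dec_; _→-dec_; _⊎-dec_)
open import Relation.Unary using (Decidable)
open import Relation.Unary.Properties using (∁?)

Consecutive : {A : Set} → A → A → List A → Set
Consecutive u v ps = ∃₂ λ xs ys → ps ≡ xs ++ u ∷ v ∷ ys

module _ {A : Set} where

  consecutive? : DecidableEquality A → ∀ u v ps → Dec (Consecutive u v ps)
  consecutive? _≟ₐ_ u v [] = no λ { ([] , _ , ()) ; (_ ∷ _ , _ , ()) }
  consecutive? _≟ₐ_ u v (x ∷ []) = no λ { ([] , _ , ()) ; (_ ∷ [] , _ , ()) ; (_ ∷ _ ∷ _ , _ , ()) }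
  consecutive? _≟ₐ_ u v (x ∷ y ∷ ps) with x ≟ₐ u ×-dec y ≟ₐ v | consecutive? _≟ₐ_ u v (y ∷ ps)
  ... | yes (refl , refl) | _              = yes ([] , ps , refl)
  ... | no _              | yes (xs , ys , eq) = yes (x ∷ xs , ys , cong (x ∷_) eq)
  ... | no ¬head          | no ¬tail       = no λ
    { ([] , _ , refl)    → ¬head (refl , refl)
    ; (_ ∷ xs , ys , eq) → ¬tail (xs , ys , ∷-injectiveʳ eq) }

  consecutive-pair⁻ : ∀ {u v a b : A} → Consecutive u v (a ∷ b ∷ []) → u ≡ a × v ≡ b
  consecutive-pair⁻ ([] , _ , refl) = refl , refl
  consecutive-pair⁻ (_ ∷ [] , _ , ())
  consecutive-pair⁻ (_ ∷ _ ∷ [] , _ , ())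
  consecutive-pair⁻ (_ ∷ _ ∷ _ ∷ _ , _ , ())

  module _ {B : Set} (f : B → A) where

    consecutive-map⁻ : ∀ {u v} ps → Consecutive u v (map f ps) →
                       ∃₂ λ u′ v′ → u ≡ f u′ × v ≡ f v′ × Consecutive u′ v′ ps
    consecutive-map⁻ (p ∷ q ∷ ps) ([] , _ , refl) = p , q , refl , refl , [] , ps , refl
    consecutive-map⁻ (p ∷ ps) (_ ∷ xs , ys , eq)
      with u′ , v′ , u≡ , v≡ , xs′ , ys′ , eq′ ← consecutive-map⁻ ps (xs , ys , ∷-injectiveʳ eq) =
      u′ , v′ , u≡ , v≡ , p ∷ xs′ , ys′ , cong (p ∷_) eq′
    consecutive-map⁻ [] ([] , _ , ())
    consecutive-map⁻ [] (_ ∷ _ , _ , ())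
    consecutive-map⁻ (_ ∷ []) ([] , _ , ())

length-filter-∁ : ∀ {A : Set} {P : A → Set} (P? : Decidable P) xs →
                  length xs ≡ length (filter P? xs) + length (filter (∁? P?) xs)
length-filter-∁ P? [] = refl
length-filter-∁ P? (x ∷ xs) with P? x
... | yes _ = cong suc (length-filter-∁ P? xs)
... | no _  = trans (cong suc (length-filter-∁ P? xs)) (sym (+-suc _ _))

unique-constant⇒length≤1 : ∀ {A : Set} {a : A} {xs} → Unique xs → All (_≡ a) xs → length xs ≤ 1
unique-constant⇒length≤1 {xs = []}        _ _ = z≤n
unique-constant⇒length≤1 {xs = _ ∷ []}    _ _ = s≤s z≤n
unique-constant⇒length≤1 {xs = _ ∷ _ ∷ _} ((x≢y ∷ _) ∷ _) (refl ∷ refl ∷ _) = ⊥-elim (x≢y refl)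

length-++-double : ∀ {A : Set} (xs ys : List A) →
  (length ys + length ys) + (length xs + length xs) ≡ length (xs ++ ys) + length (xs ++ ys)
length-++-double xs ys rewrite length-++ xs {ys} = swap-doubles (length xs) (length ys)
  where
  swap-doubles : ∀ a b → (b + b) + (a + a) ≡ (a + b) + (a + b)
  swap-doubles = solve-∀

pick-longer : ∀ {A : Set} (P : List A → Set) {X Y} → P X → P Y →
              Σ (List A) λ Z → P Z × length X + length Y ≤ length Z + length Z
pick-longer P {X} {Y} pX pY with length X ≤? length Y
... | yes X≤Y = Y , pY , +-monoˡ-≤ (length Y) X≤Y
... | no X≰Y  = X , pX , +-monoʳ-≤ (length X) (≰⇒≥ X≰Y)

module _ {n : ℕ} where

  usesEdge? : (u v : Fin n) (ps : List (Fin n)) → Dec (UsesEdge u v ps)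
  usesEdge? u v ps = consecutive? _≟_ u v ps ⊎-dec consecutive? _≟_ v u ps

  usesEdge-pair⁻ : ∀ {u v a b : Fin n} → UsesEdge u v (a ∷ b ∷ []) → (u ≡ a × v ≡ b) ⊎ (u ≡ b × v ≡ a)
  usesEdge-pair⁻ (inj₁ uv) = inj₁ (consecutive-pair⁻ uv)
  usesEdge-pair⁻ (inj₂ vu) with refl , refl ← consecutive-pair⁻ vu = inj₂ (refl , refl)

  usesEdge-map⁻ : ∀ {m} (f : Fin m → Fin n) {u v} ps → UsesEdge u v (map f ps) →
                  ∃₂ λ u′ v′ → u ≡ f u′ × v ≡ f v′ × UsesEdge u′ v′ ps
  usesEdge-map⁻ f ps (inj₁ uv) with u′ , v′ , u≡ , v≡ , c ← consecutive-map⁻ f ps uv =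
    u′ , v′ , u≡ , v≡ , inj₁ c
  usesEdge-map⁻ f ps (inj₂ vu) with v′ , u′ , v≡ , u≡ , c ← consecutive-map⁻ f ps vu =
    u′ , v′ , u≡ , v≡ , inj₂ c

module _ {n : ℕ} (G : Graph n) where

  NonAdj : Fin n → Fin n → Set
  NonAdj u v = adj G u v ≡ false

  Clique : List (Fin n) → Set
  Clique = AllPairs (Adj G)

  Adj? : ∀ u v → Dec (Adj G u v)
  Adj? u v = adj G u v ≟ᵇ true

  Adj-sym : ∀ {u v} → Adj G u v → Adj G v u
  Adj-sym {u} {v} uv = trans (Graph.sym G v u) uv

  NonAdj-sym : ∀ {u v} → NonAdj u v → NonAdj v u
  NonAdj-sym {u} {v} uv = trans (Graph.sym G v u) uv

  ¬Adj⇒NonAdj : ∀ {u v} → ¬ Adj G u v → NonAdj u v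
  ¬Adj⇒NonAdj = ¬-not

  ¬NonAdj⇒Adj : ∀ {u v} → ¬ NonAdj u v → Adj G u v
  ¬NonAdj⇒Adj = ¬-not

  Adj⇒¬NonAdj : ∀ {u v} → Adj G u v → ¬ NonAdj u v
  Adj⇒¬NonAdj uv ¬uv with () ← trans (sym uv) ¬uv

  Adj⇒≢ : ∀ {u v} → Adj G u v → u ≢ v
  Adj⇒≢ {u} uu refl with () ← trans (sym (irrefl G u)) uu

  Adj-NonAdj⇒≢ : ∀ {u x y} → Adj G u x → NonAdj u y → x ≢ y
  Adj-NonAdj⇒≢ ux uy refl = Adj⇒¬NonAdj ux uy

-- Immersions along subgraph embeddings

SubgraphEmbedding : ∀ {k n} → Graph k → Graph n → Set
SubgraphEmbedding {k} {n} H G =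
  Σ (Fin k → Fin n) λ f → Injective _≡_ _≡_ f × (∀ {i j} → Adj H i j → Adj G (f i) (f j))

induced⇒subgraphEmbedding : ∀ {k n} {G : Graph n} {H : Graph k} → HasInducedSubgraph G H → SubgraphEmbedding H G
induced⇒subgraphEmbedding (f , f-inj , f-adj) = f , f-inj , λ {i} {j} ij → trans (f-adj i j) ij

immersion-transport : ∀ {k n m} {H : Graph k} {G : Graph n} →
                      SubgraphEmbedding H G → ImmersesComplete H m → ImmersesComplete G m
immersion-transport {G = G} (f , f-inj , f-adj) (φ , P , φ-inj , paths , interior , disjoint) =
  f ∘ φ , P′ , φ-inj ∘ f-inj , paths′ , interior′ , disjoint′
  where
  P′ : Fin _ → Fin _ → List (Fin _)
  P′ i j = map f (P i j)

  fullPath-map : ∀ i j → fullPath (f (φ i)) (P′ i j) (f (φ j)) ≡ map f (fullPath (φ i) (P i j) (φ j))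
  fullPath-map i j = cong (f (φ i) ∷_) (sym (map-++ f (P i j) (φ j ∷ [])))

  paths′ : ∀ i j → i <ᶠ j → IsPath G (f (φ i)) (P′ i j) (f (φ j))
  paths′ i j i<j rewrite fullPath-map i j with linked , unique ← paths i j i<j =
    Linked.map⁺ (Linked.map f-adj linked) , Unique.map⁺ f-inj unique

  interior′ : ∀ i j → i <ᶠ j → ∀ x → x ∈ P′ i j → ∀ k → x ≢ f (φ k)
  interior′ i j i<j x x∈P′ k x≡ with y , y∈P , refl ← ∈-map⁻ f x∈P′ =
    interior i j i<j y y∈P k (f-inj x≡)

  disjoint′ : ∀ i j k l → i <ᶠ j → k <ᶠ l → ¬ (i ≡ k × j ≡ l) → ∀ u v →
              UsesEdge u v (fullPath (f (φ i)) (P′ i j) (f (φ j))) →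
              ¬ UsesEdge u v (fullPath (f (φ k)) (P′ k l) (f (φ l)))
  disjoint′ i j k l i<j k<l ij≢kl u v U V
    rewrite fullPath-map i j | fullPath-map k l
    with u₁ , v₁ , refl , refl , U₁ ← usesEdge-map⁻ f _ U
       | _ , _ , u₁≡ , v₁≡ , V₂ ← usesEdge-map⁻ f _ V
    with refl ← f-inj u₁≡ | refl ← f-inj v₁≡ =
    disjoint i j k l i<j k<l ij≢kl u₁ v₁ U₁ V₂

Complete : (m : ℕ) → Graph m
Complete m = record { adj = λ i j → not (does (i ≟ j)) ; sym = ≟-sym ; irrefl = ≟-refl }
  where
  ≟-sym : ∀ i j → not (does (i ≟ j)) ≡ not (does (j ≟ i))
  ≟-sym i j with i ≟ j | j ≟ i
  ... | yes _    | yes _    = refl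
  ... | no _     | no _     = refl
  ... | yes refl | no j≢i   = ⊥-elim (j≢i refl)
  ... | no i≢j   | yes refl = ⊥-elim (i≢j refl)
  ≟-refl : ∀ i → not (does (i ≟ i)) ≡ false
  ≟-refl i with i ≟ i
  ... | yes _  = refl
  ... | no i≢i = ⊥-elim (i≢i refl)

≢⇒Adj-Complete : ∀ {m} {i j : Fin m} → i ≢ j → Adj (Complete m) i j
≢⇒Adj-Complete {i = i} {j} i≢j with i ≟ j
... | yes i≡j = ⊥-elim (i≢j i≡j)
... | no _    = refl

complete-immerses-itself : ∀ m → ImmersesComplete (Complete m) m
complete-immerses-itself m = id , (λ _ _ → []) , id , edge , (λ _ _ _ _ ()) , disjoint
  where
  edge : ∀ i j → i <ᶠ j → IsPath (Complete m) i [] j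
  edge i j i<j = (≢⇒Adj-Complete (<⇒≢ i<j) ∷ [-]) , ((<⇒≢ i<j ∷ []) ∷ [] ∷ [])
  disjoint : ∀ i j k l → i <ᶠ j → k <ᶠ l → ¬ (i ≡ k × j ≡ l) → ∀ u v →
             UsesEdge u v (i ∷ j ∷ []) → ¬ UsesEdge u v (k ∷ l ∷ [])
  disjoint i j k l i<j k<l ij≢kl u v U V with usesEdge-pair⁻ U | usesEdge-pair⁻ V
  ... | inj₁ (refl , refl) | inj₁ (refl , refl) = ij≢kl (refl , refl)
  ... | inj₂ (refl , refl) | inj₂ (refl , refl) = ij≢kl (refl , refl)
  ... | inj₁ (refl , refl) | inj₂ (refl , refl) = <-asym i<j k<l
  ... | inj₂ (refl , refl) | inj₁ (refl , refl) = <-asym i<j k<l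

module _ {n : ℕ} (G : Graph n) where

  clique-lookup : ∀ {K} → Clique G K → ∀ {i j} → i ≢ j → Adj G (lookup K i) (lookup K j)
  clique-lookup (_ ∷ _)    {zero}  {zero}  0≢0 = ⊥-elim (0≢0 refl)
  clique-lookup (x≈K ∷ _)  {zero}  {suc j} _   = All.lookup x≈K (∈-lookup j)
  clique-lookup (x≈K ∷ _)  {suc i} {zero}  _   = Adj-sym G (All.lookup x≈K (∈-lookup i))
  clique-lookup (_ ∷ K-cl) {suc i} {suc j} i≢j = clique-lookup K-cl (i≢j ∘ cong suc)

  clique⇒subgraphEmbedding : ∀ {K m} → Clique G K → m ≤ length K → SubgraphEmbedding (Complete m) G
  clique⇒subgraphEmbedding {K} K-cl m≤K = f , injective , hom
    where
    f : Fin _ → Fin n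
    f i = lookup K (inject≤ i m≤K)
    hom : ∀ {i j} → Adj (Complete _) i j → Adj G (f i) (f j)
    hom {i} {j} ij = clique-lookup K-cl (Adj⇒≢ (Complete _) ij ∘ inject≤-injective _ _ i j)
    injective : Injective _≡_ _≡_ f
    injective {i} {j} fi≡fj with i ≟ j
    ... | yes i≡j = i≡j
    ... | no i≢j  = ⊥-elim (Adj⇒≢ G (hom (≢⇒Adj-Complete i≢j)) fi≡fj)

  clique⇒immersion : ∀ {K m} → Clique G K → m ≤ length K → ImmersesComplete G m
  clique⇒immersion K-cl m≤K =
    immersion-transport {H = Complete _} {G} (clique⇒subgraphEmbedding K-cl m≤K) (complete-immerses-itself _)

cycleSucc : Fin 5 → Fin 5
cycleSucc zero                         = suc zero
cycleSucc (suc zero)                   = suc (suc zero)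
cycleSucc (suc (suc zero))             = suc (suc (suc zero))
cycleSucc (suc (suc (suc zero)))       = suc (suc (suc (suc zero)))
cycleSucc (suc (suc (suc (suc zero)))) = zero

c5adj : Fin 5 → Fin 5 → Bool
c5adj i j = does (cycleSucc i ≟ j) ∨ does (cycleSucc j ≟ i)

C5 : Graph 5
C5 = record
  { adj    = c5adj
  ; sym    = from-yes (all? λ i → all? λ j → c5adj i j ≟ᵇ c5adj j i)
  ; irrefl = from-yes (all? λ i → c5adj i i ≟ᵇ false)
  }

-- Branch vertices 0, 1, 2, with the detour 0 - 4 - 3 - 2 for the third edge.
C5-immerses-K3 : ImmersesComplete C5 3
C5-immerses-K3 =
    φ , P
  , (λ {i} {j} → φ-injective i j)
  , from-yes (all? λ i → all? λ j → i <? j →-dec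
      linked? (Adj? C5) (path i j) ×-dec unique? (path i j))
  , from-yes (all? λ i → all? λ j → i <? j →-dec
      all? λ x → x ∈? P i j →-dec all? λ k → ¬? (x ≟ φ k))
  , from-yes (all? λ i → all? λ j → all? λ k → all? λ l →
      i <? j →-dec k <? l →-dec ¬? (i ≟ k ×-dec j ≟ l) →-dec all? λ u → all? λ v →
      usesEdge? u v (path i j) →-dec ¬? (usesEdge? u v (path k l)))
  where
  open import Data.List.Membership.DecPropositional (_≟_ {5}) using (_∈?_)
  open import Data.List.Relation.Unary.Unique.DecPropositional (_≟_ {5}) using (unique?)
  φ : Fin 3 → Fin 5
  φ i = Vec.lookup (zero ∷ suc zero ∷ suc (suc zero) ∷ []) i
  P : Fin 3 → Fin 3 → List (Fin 5)
  P zero (suc (suc zero)) = suc (suc (suc (suc zero))) ∷ suc (suc (suc zero)) ∷ []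
  P _    _                = []
  path : Fin 3 → Fin 3 → List (Fin 5)
  path i j = fullPath (φ i) (P i j) (φ j)
  φ-injective : ∀ i j → φ i ≡ φ j → i ≡ j
  φ-injective = from-yes (all? λ i → all? λ j → φ i ≟ φ j →-dec i ≟ j)

-- Small induced subgraphs

TwinFree : ∀ {k} → Graph k → Set
TwinFree H = ∀ i j → (∀ l → adj H i l ≡ adj H j l) → i ≡ j

twinFree? : ∀ {k} (H : Graph k) → Dec (TwinFree H)
twinFree? H = all? λ i → all? λ j → all? (λ l → adj H i l ≟ᵇ adj H j l) →-dec i ≟ j

upperPairs : ∀ k → List (Fin k × Fin k)
upperPairs k = filter (uncurry _<?_) (cartesianProduct (allFin k) (allFin k))

∈-upperPairs : ∀ {k} {i j : Fin k} → i <ᶠ j → (i , j) ∈ upperPairs k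
∈-upperPairs i<j = ∈-filter⁺ (uncurry _<?_) (∈-cartesianProduct⁺ (∈-allFin _) (∈-allFin _)) i<j

module _ {n : ℕ} (G : Graph n) where

  -- For concrete k the All over upperPairs k normalises to one hypothesis per pair i < j.
  inducedSubgraph-byUpperPairs : ∀ {k} (H : Graph k) → TwinFree H → (f : Fin k → Fin n) →
    All (λ (i , j) → adj G (f i) (f j) ≡ adj H i j) (upperPairs k) → HasInducedSubgraph G H
  inducedSubgraph-byUpperPairs H H-twinFree f upper = f , injective , table
    where
    table : ∀ i j → adj G (f i) (f j) ≡ adj H i j
    table i j with <-cmp i j
    ... | tri< i<j _ _ = All.lookup upper (∈-upperPairs i<j)
    ... | tri≈ _ refl _ = trans (irrefl G (f i)) (sym (irrefl H i))
    ... | tri> _ _ j<i =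
      trans (Graph.sym G (f i) (f j)) (trans (All.lookup upper (∈-upperPairs j<i)) (Graph.sym H j i))
    injective : Injective _≡_ _≡_ f
    injective {i} {j} fi≡fj =
      H-twinFree i j λ l → trans (sym (table i l)) (trans (cong (λ x → adj G x (f l)) fi≡fj) (table j l))

  inducedP4 : ∀ {a b c d} → Adj G a b → NonAdj G a c → NonAdj G a d →
              Adj G b c → NonAdj G b d → Adj G c d → HasInducedSubgraph G P4
  inducedP4 {a} {b} {c} {d} ab ac ad bc bd cd =
    inducedSubgraph-byUpperPairs P4 (from-yes (twinFree? P4)) (Vec.lookup (a ∷ b ∷ c ∷ d ∷ []))
      (ab ∷ ac ∷ ad ∷ bc ∷ bd ∷ cd ∷ [])

  inducedPaw : ∀ {a b c d} → Adj G a b → Adj G a c → NonAdj G a d →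
               Adj G b c → NonAdj G b d → Adj G c d → HasInducedSubgraph G K3e
  inducedPaw {a} {b} {c} {d} ab ac ad bc bd cd =
    inducedSubgraph-byUpperPairs K3e (from-yes (twinFree? K3e)) (Vec.lookup (a ∷ b ∷ c ∷ d ∷ []))
      (ab ∷ ac ∷ ad ∷ bc ∷ bd ∷ cd ∷ [])

  inducedC5 : ∀ {a b c d e} →
              Adj G a b → NonAdj G a c → NonAdj G a d → Adj G a e →
              Adj G b c → NonAdj G b d → NonAdj G b e →
              Adj G c d → NonAdj G c e → Adj G d e → HasInducedSubgraph G C5
  inducedC5 {a} {b} {c} {d} {e} ab ac ad ae bc bd be cd ce de =
    inducedSubgraph-byUpperPairs C5 (from-yes (twinFree? C5)) (Vec.lookup (a ∷ b ∷ c ∷ d ∷ e ∷ []))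
      (ab ∷ ac ∷ ad ∷ ae ∷ bc ∷ bd ∷ be ∷ cd ∷ ce ∷ de ∷ [])

  inducedC5⇒immersion : HasInducedSubgraph G C5 → ImmersesComplete G 3
  inducedC5⇒immersion c5 =
    immersion-transport {H = C5} {G} (induced⇒subgraphEmbedding {G = G} {C5} c5) C5-immerses-K3

-- Cliques on half of a vertex list

module _ {n : ℕ} (G : Graph n) where

  HalfClique : List (Fin n) → Set
  HalfClique R = Σ (List (Fin n)) λ K → Clique G K × All (_∈ R) K × length R ≤ length K + length K

  halfClique-∷ : ∀ {v R} → All (Adj G v) R → HalfClique R → HalfClique (v ∷ R)
  halfClique-∷ {v} v⇉R (K , K-clique , K⊆R , R≤2K) =
    v ∷ K , All.map (All.lookup v⇉R) K⊆R ∷ K-clique , here refl ∷ All.map there K⊆R ,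
    s≤s (≤-trans R≤2K (+-monoʳ-≤ (length K) (n≤1+n (length K))))

  -- The size bound says that w is the only vertex of R adjacent to neither v nor w;
  -- α(G) ≤ 2 guarantees it.
  record Split (v w : Fin n) (R B C D : List (Fin n)) : Set where
    field
      B-class   : ∀ {x} → x ∈ B → x ∈ R × Adj G v x × NonAdj G w x
      C-class   : ∀ {x} → x ∈ C → x ∈ R × NonAdj G v x × Adj G w x
      D-class   : ∀ {x} → x ∈ D → x ∈ R × Adj G v x × Adj G w x
      w∈R       : w ∈ R
      v≁w       : NonAdj G v w
      vB-clique : Clique G (v ∷ B)
      wC-clique : Clique G (w ∷ C)
      D-unique  : Unique D
      size      : length (v ∷ R) ≤ length (v ∷ B) + length (w ∷ C) + length D

    vB⊆ : All (_∈ v ∷ R) (v ∷ B)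
    vB⊆ = here refl ∷ All.tabulate (there ∘ proj₁ ∘ B-class)

    wC⊆ : All (_∈ v ∷ R) (w ∷ C)
    wC⊆ = there w∈R ∷ All.tabulate (there ∘ proj₁ ∘ C-class)

    extend : ∀ {K} → Clique G K → All (_∈ D) K → length D ≤ length K + length K →
             All (λ x → All (Adj G x) B × All (Adj G x) C) K → HalfClique (v ∷ R)
    extend {K} K-clique K⊆D D≤2K K⇉BC =
      join-larger (pick-longer Side (vB-clique , vB⊆ , K⇉vB) (wC-clique , wC⊆ , K⇉wC))
      where
      Side : List (Fin n) → Set
      Side Z = Clique G Z × All (_∈ v ∷ R) Z × All (λ x → All (Adj G x) Z) K

      K⇉vB : All (λ x → All (Adj G x) (v ∷ B)) K
      K⇉vB = All.zipWith (λ (x∈D , x⇉B , _) → Adj-sym G (proj₁ (proj₂ (D-class x∈D))) ∷ x⇉B) (K⊆D , K⇉BC)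

      K⇉wC : All (λ x → All (Adj G x) (w ∷ C)) K
      K⇉wC = All.zipWith (λ (x∈D , _ , x⇉C) → Adj-sym G (proj₂ (proj₂ (D-class x∈D))) ∷ x⇉C) (K⊆D , K⇉BC)

      join-larger : Σ (List (Fin n)) (λ Z → Side Z × length (v ∷ B) + length (w ∷ C) ≤ length Z + length Z) →
                    HalfClique (v ∷ R)
      join-larger (Z , (Z-clique , Z⊆ , K⇉Z) , BC≤2Z) =
        K ++ Z , AllPairs.++⁺ K-clique Z-clique K⇉Z , All.++⁺ (All.map (there ∘ proj₁ ∘ D-class) K⊆D) Z⊆ ,
        (begin
          length (v ∷ R)                                  ≤⟨ size ⟩
          length (v ∷ B) + length (w ∷ C) + length D      ≤⟨ +-mono-≤ BC≤2Z D≤2K ⟩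
          (length Z + length Z) + (length K + length K)   ≡⟨ length-++-double K Z ⟩
          length (K ++ Z) + length (K ++ Z)               ∎)
        where open ≤-Reasoning

  InducedC5Within : List (Fin n) → Set
  InducedC5Within R = Σ (HasInducedSubgraph G C5) λ c5 → All (λ i → proj₁ c5 i ∈ R) (allFin 5)

  HalfCliqueOrC5 : List (Fin n) → Set
  HalfCliqueOrC5 R = HalfClique R ⊎ (length R ≡ 5 × InducedC5Within R)

  C5-dominated⇒paw : ∀ {v} (c5 : HasInducedSubgraph G C5) →
                     All (λ i → Adj G v (proj₁ c5 i)) (allFin 5) → HasInducedSubgraph G K3e
  C5-dominated⇒paw (f , _ , table) (v₀ ∷ v₁ ∷ _ ∷ v₃ ∷ _) =
    inducedPaw G (table zero (suc zero)) (Adj-sym G v₀) (table zero (suc (suc (suc zero))))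
                 (Adj-sym G v₁) (table (suc zero) (suc (suc (suc zero)))) v₃

module _ {n : ℕ} (G : Graph n) (α : IndepNumberAtMost2 G) where

  common-nonNeighbours-adjacent : ∀ {a x y} → x ≢ y → a ≢ x → a ≢ y →
                                  NonAdj G a x → NonAdj G a y → Adj G x y
  common-nonNeighbours-adjacent x≢y a≢x a≢y ax ay with α _ _ _ a≢x a≢y x≢y
  ... | inj₁ ax′        = ⊥-elim (Adj⇒¬NonAdj G ax′ ax)
  ... | inj₂ (inj₁ ay′) = ⊥-elim (Adj⇒¬NonAdj G ay′ ay)
  ... | inj₂ (inj₂ xy)  = xy

  nonNeighbourhood-clique : ∀ {a K} → Unique K → All (λ x → a ≢ x × NonAdj G a x) K → Clique G K
  nonNeighbourhood-clique []           []          = []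
  nonNeighbourhood-clique (x≢K ∷ K-un) (ax ∷ aK) =
    All.zipWith (λ (x≢y , ay) → common-nonNeighbours-adjacent x≢y (proj₁ ax) (proj₁ ay) (proj₂ ax) (proj₂ ay))
      (x≢K , aK)
    ∷ nonNeighbourhood-clique K-un aK

  neighboursOf nonNeighboursOf : Fin n → List (Fin n) → List (Fin n)
  neighboursOf v    = filter (Adj? G v)
  nonNeighboursOf v = filter (∁? (Adj? G v))

  split : ∀ {v w R} → Unique (v ∷ R) → w ∈ R → NonAdj G v w →
          Split G v w R (nonNeighboursOf w (neighboursOf v R))
                      (filter (∁? (_≟ w)) (nonNeighboursOf v R))
                      (neighboursOf w (neighboursOf v R))
  split {v} {w} {R} (v∉R ∷ R-unique) w∈R v≁w = record
    { B-class   = B-class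
    ; C-class   = C-class
    ; D-class   = D-class
    ; w∈R       = w∈R
    ; v≁w       = v≁w
    ; vB-clique = All.tabulate (proj₁ ∘ proj₂ ∘ B-class)
                  ∷ nonNeighbourhood-clique B-unique (All.tabulate w-apart-B)
    ; wC-clique = All.tabulate (proj₂ ∘ proj₂ ∘ C-class)
                  ∷ nonNeighbourhood-clique C-unique (All.tabulate v-apart-C)
    ; D-unique  = Unique.filter⁺ (Adj? G w) N-unique
    ; size      = s≤s R-bound
    }
    where
    N nonN W B C D : List (Fin n)
    N    = neighboursOf v R
    nonN = nonNeighboursOf v R
    W    = filter (_≟ w) nonN
    B    = nonNeighboursOf w N
    C    = filter (∁? (_≟ w)) nonN
    D    = neighboursOf w N

    v≢ : ∀ {x} → x ∈ R → v ≢ x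
    v≢ = All.lookup v∉R

    N-unique B-unique C-unique : Unique _
    N-unique = Unique.filter⁺ (Adj? G v) R-unique
    B-unique = Unique.filter⁺ (∁? (Adj? G w)) N-unique
    C-unique = Unique.filter⁺ (∁? (_≟ w)) (Unique.filter⁺ (∁? (Adj? G v)) R-unique)

    B-class : ∀ {x} → x ∈ B → x ∈ R × Adj G v x × NonAdj G w x
    B-class x∈B =
      let x∈N , ¬wx = ∈-filter⁻ (∁? (Adj? G w)) {xs = N} x∈B
          x∈R , vx  = ∈-filter⁻ (Adj? G v) x∈N
      in x∈R , vx , ¬Adj⇒NonAdj G ¬wx

    C-class : ∀ {x} → x ∈ C → x ∈ R × NonAdj G v x × Adj G w x
    C-class x∈C =
      let x∈nonN , x≢w = ∈-filter⁻ (∁? (_≟ w)) {xs = nonN} x∈C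
          x∈R , ¬vx    = ∈-filter⁻ (∁? (Adj? G v)) x∈nonN
          v≁x          = ¬Adj⇒NonAdj G ¬vx
      in x∈R , v≁x , common-nonNeighbours-adjacent (x≢w ∘ sym) (v≢ w∈R) (v≢ x∈R) v≁w v≁x

    D-class : ∀ {x} → x ∈ D → x ∈ R × Adj G v x × Adj G w x
    D-class x∈D =
      let x∈N , wx = ∈-filter⁻ (Adj? G w) {xs = N} x∈D
          x∈R , vx = ∈-filter⁻ (Adj? G v) x∈N
      in x∈R , vx , wx

    w-apart-B : ∀ {x} → x ∈ B → w ≢ x × NonAdj G w x
    w-apart-B x∈B with _ , vx , wx ← B-class x∈B = Adj-NonAdj⇒≢ G vx v≁w ∘ sym , wx

    v-apart-C : ∀ {x} → x ∈ C → v ≢ x × NonAdj G v x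
    v-apart-C x∈C with x∈R , vx , _ ← C-class x∈C = v≢ x∈R , vx

    R-bound : length R ≤ length B + suc (length C) + length D
    R-bound = begin
      length R                                           ≡⟨ length-filter-∁ (Adj? G v) R ⟩
      length N + length nonN                             ≡⟨ cong₂ _+_ (length-filter-∁ (Adj? G w) N)
                                                                       (length-filter-∁ (_≟ w) nonN) ⟩
      (length D + length B) + (length W + length C)      ≤⟨ +-monoʳ-≤ (length D + length B) (+-monoˡ-≤ (length C) W≤1) ⟩
      (length D + length B) + (1 + length C)             ≡⟨ rearrange (length B) (length C) (length D) ⟩
      length B + suc (length C) + length D               ∎
      where
      open ≤-Reasoning
      W≤1 : length W ≤ 1
      W≤1 = unique-constant⇒length≤1 (Unique.filter⁺ (_≟ w) (Unique.filter⁺ (∁? (Adj? G v)) R-unique))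
                                     (All.all-filter (_≟ w) nonN)
      rearrange : ∀ b c d → (d + b) + (1 + c) ≡ b + suc c + d
      rearrange = solve-∀

  split-induction : (Q : List (Fin n) → Set) → Q [] →
    (∀ {v R} → All (Adj G v) R → Q R → Q (v ∷ R)) →
    (∀ {v w R B C D} → Split G v w R B C D → Q D → Q (v ∷ R)) →
    ∀ R → Unique R → Q R
  split-induction Q base dominating splitting R R-unique = go R R-unique (<-wellFounded (length R))
    where
    go : ∀ R → Unique R → Acc _<_ (length R) → Q R
    go []      _ _ = base
    go (v ∷ R) vR-unique@(_ ∷ R-unique) (acc shorter) with All.all? (Adj? G v) R
    ... | yes v⇉R = dominating v⇉R (go R R-unique (shorter ≤-refl))
    ... | no ¬v⇉R with w , w∈R , ¬vw ← find (All.¬All⇒Any¬ (Adj? G v) R ¬v⇉R) =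
      splitting S (go _ (Split.D-unique S) (shorter (s≤s D≤R)))
      where
      S : Split G v w R _ _ _
      S = split vR-unique w∈R (¬Adj⇒NonAdj G ¬vw)
      D≤R : length (neighboursOf w (neighboursOf v R)) ≤ length R
      D≤R = ≤-trans (length-filter (Adj? G w) (neighboursOf v R)) (length-filter (Adj? G v) R)

  halfClique-P4-free : ¬ HasInducedSubgraph G P4 → ∀ R → Unique R → HalfClique G R
  halfClique-P4-free noP4 = split-induction (HalfClique G) ([] , [] , [] , z≤n) (halfClique-∷ G) step
    where
    step : ∀ {v w R B C D} → Split G v w R B C D → HalfClique G D → HalfClique G (v ∷ R)
    step {B = B} {C} {D} S (K , K-clique , K⊆D , D≤2K) =
      extend K-clique K⊆D D≤2K (All.map (λ x∈D → All.tabulate (B-joined x∈D) , All.tabulate (C-joined x∈D)) K⊆D)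
      where
      open Split S
      -- otherwise w - x - v - b, resp. v - x - w - c, is an induced P4
      B-joined : ∀ {x b} → x ∈ D → b ∈ B → Adj G x b
      B-joined x∈D b∈B with _ , vx , wx ← D-class x∈D | _ , vb , w≁b ← B-class b∈B =
        ¬NonAdj⇒Adj G λ x≁b → noP4 (inducedP4 G wx (NonAdj-sym G v≁w) w≁b (Adj-sym G vx) x≁b vb)
      C-joined : ∀ {x c} → x ∈ D → c ∈ C → Adj G x c
      C-joined x∈D c∈C with _ , vx , wx ← D-class x∈D | _ , v≁c , wc ← C-class c∈C =
        ¬NonAdj⇒Adj G λ x≁c → noP4 (inducedP4 G vx v≁w v≁c (Adj-sym G wx) x≁c wc)

  module PawFreeSplit (noPaw : ¬ HasInducedSubgraph G K3e)
                      {v w R B C D} (S : Split G v w R B C D) where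
    open Split S public

    -- otherwise v b x, resp. w c x, is a triangle with the pendant vertex w, resp. v, at x
    D≁B : ∀ {x b} → x ∈ D → b ∈ B → NonAdj G x b
    D≁B x∈D b∈B with _ , vx , wx ← D-class x∈D | _ , vb , w≁b ← B-class b∈B =
      ¬Adj⇒NonAdj G λ xb → noPaw (inducedPaw G vb vx v≁w (Adj-sym G xb) (NonAdj-sym G w≁b) (Adj-sym G wx))

    D≁C : ∀ {x c} → x ∈ D → c ∈ C → NonAdj G x c
    D≁C x∈D c∈C with _ , vx , wx ← D-class x∈D | _ , v≁c , wc ← C-class c∈C =
      ¬Adj⇒NonAdj G λ xc → noPaw (inducedPaw G wc wx (NonAdj-sym G v≁w) (Adj-sym G xc) (NonAdj-sym G v≁c) (Adj-sym G vx))

    B⇉C : ∀ {x b c} → x ∈ D → b ∈ B → c ∈ C → Adj G b c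
    B⇉C x∈D b∈B c∈C with _ , vx , wx ← D-class x∈D | _ , vb , w≁b ← B-class b∈B | _ , v≁c , wc ← C-class c∈C =
      common-nonNeighbours-adjacent (Adj-NonAdj⇒≢ G vb v≁c) (Adj-NonAdj⇒≢ G wx w≁b) (Adj-NonAdj⇒≢ G vx v≁c)
        (D≁B x∈D b∈B) (D≁C x∈D c∈C)

    two-in-D-and-B⇒paw : ∀ {x y b} → x ≢ y → x ∈ D → y ∈ D → b ∈ B → HasInducedSubgraph G K3e
    two-in-D-and-B⇒paw {x} {y} x≢y x∈D y∈D b∈B
      with _ , vx , wx ← D-class x∈D | _ , vy , wy ← D-class y∈D | _ , vb , w≁b ← B-class b∈B =
      inducedPaw G xy (Adj-sym G vx) (D≁B x∈D b∈B) (Adj-sym G vy) (D≁B y∈D b∈B) vb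
      where
      xy : Adj G x y
      xy = common-nonNeighbours-adjacent x≢y (Adj-NonAdj⇒≢ G wx w≁b ∘ sym) (Adj-NonAdj⇒≢ G wy w≁b ∘ sym)
             (NonAdj-sym G (D≁B x∈D b∈B)) (NonAdj-sym G (D≁B y∈D b∈B))

    two-in-D-and-C⇒paw : ∀ {x y c} → x ≢ y → x ∈ D → y ∈ D → c ∈ C → HasInducedSubgraph G K3e
    two-in-D-and-C⇒paw {x} {y} x≢y x∈D y∈D c∈C
      with _ , vx , wx ← D-class x∈D | _ , vy , wy ← D-class y∈D | _ , v≁c , wc ← C-class c∈C =
      inducedPaw G xy (Adj-sym G wx) (D≁C x∈D c∈C) (Adj-sym G wy) (D≁C y∈D c∈C) wc
      where
      xy : Adj G x y
      xy = common-nonNeighbours-adjacent x≢y (Adj-NonAdj⇒≢ G vx v≁c ∘ sym) (Adj-NonAdj⇒≢ G vy v≁c ∘ sym)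
             (NonAdj-sym G (D≁C x∈D c∈C)) (NonAdj-sym G (D≁C y∈D c∈C))

    one-in-D-bound : length D ≡ 1 → length (v ∷ R) ≤ 3 + (length B + length C)
    one-in-D-bound D≡1 = ≤-trans size (≤-reflexive (trans (cong (length (v ∷ B) + length (w ∷ C) +_) D≡1)
                                                          (shift (length B) (length C))))
      where
      shift : ∀ b c → suc b + suc c + 1 ≡ 3 + (b + c)
      shift = solve-∀

    B++C-halfClique : ∀ {x} → x ∈ D → length D ≡ 1 → 3 ≤ length B + length C → HalfClique G (v ∷ R)
    B++C-halfClique x∈D D≡1 3≤BC =
        B ++ C
      , AllPairs.++⁺ (AllPairs.tail vB-clique) (AllPairs.tail wC-clique)
                     (All.tabulate λ b∈B → All.tabulate (B⇉C x∈D b∈B))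
      , All.++⁺ (All.tail vB⊆) (All.tail wC⊆)
      , bound
      where
      open ≤-Reasoning
      bound : length (v ∷ R) ≤ length (B ++ C) + length (B ++ C)
      bound = begin
        length (v ∷ R)                                      ≤⟨ one-in-D-bound D≡1 ⟩
        3 + (length B + length C)                           ≤⟨ +-monoˡ-≤ (length B + length C) 3≤BC ⟩
        (length B + length C) + (length B + length C)       ≡⟨ sym (cong₂ _+_ (length-++ B) (length-++ B)) ⟩
        length (B ++ C) + length (B ++ C)                   ∎

    five-cycle : ∀ {x b c} → x ∈ D → b ∈ B → c ∈ C → InducedC5Within G (v ∷ R)
    five-cycle x∈D b∈B c∈C
      with x∈R , vx , wx ← D-class x∈D | b∈R , vb , w≁b ← B-class b∈B | c∈R , v≁c , wc ← C-class c∈C =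
        inducedC5 G (Adj-sym G vb) (NonAdj-sym G (D≁B x∈D b∈B)) (NonAdj-sym G w≁b) (B⇉C x∈D b∈B c∈C)
                    vx v≁w v≁c (Adj-sym G wx) (D≁C x∈D c∈C) wc
      , there b∈R ∷ here refl ∷ there x∈R ∷ there w∈R ∷ there c∈R ∷ []

  halfCliqueOrC5-paw-free : ¬ HasInducedSubgraph G K3e → ∀ R → Unique R → HalfCliqueOrC5 G R
  halfCliqueOrC5-paw-free noPaw = split-induction (HalfCliqueOrC5 G) (inj₁ ([] , [] , [] , z≤n)) dominating step
    where
    dominating : ∀ {v R} → All (Adj G v) R → HalfCliqueOrC5 G R → HalfCliqueOrC5 G (v ∷ R)
    dominating v⇉R (inj₁ R-half)          = inj₁ (halfClique-∷ G v⇉R R-half)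
    dominating v⇉R (inj₂ (_ , c5 , c5⊆R)) = ⊥-elim (noPaw (C5-dominated⇒paw G c5 (All.map (All.lookup v⇉R) c5⊆R)))

    step : ∀ {v w R B C D} → Split G v w R B C D → HalfCliqueOrC5 G D → HalfCliqueOrC5 G (v ∷ R)
    step {B = []} {C = []} S (inj₁ (K , K-clique , K⊆D , D≤2K)) =
      inj₁ (Split.extend S K-clique K⊆D D≤2K (All.map (λ _ → [] , []) K⊆D))
    step {B = []} {C = []} S (inj₂ (_ , c5 , c5⊆D)) =
      ⊥-elim (noPaw (C5-dominated⇒paw G c5 (All.map (proj₁ ∘ proj₂ ∘ Split.D-class S) c5⊆D)))
    step {D = []} S _ = inj₁ (Split.extend S [] [] z≤n [])
    step {B = _ ∷ _} {D = _ ∷ _ ∷ _} S _ with (x≢y ∷ _) ∷ _ ← Split.D-unique S =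
      ⊥-elim (noPaw (two-in-D-and-B⇒paw x≢y (here refl) (there (here refl)) (here refl)))
      where open PawFreeSplit noPaw S
    step {C = _ ∷ _} {D = _ ∷ _ ∷ _} S _ with (x≢y ∷ _) ∷ _ ← Split.D-unique S =
      ⊥-elim (noPaw (two-in-D-and-C⇒paw x≢y (here refl) (there (here refl)) (here refl)))
      where open PawFreeSplit noPaw S
    step {w = w} {B = []} {C = c ∷ C} {D = _ ∷ []} S _ =
      inj₁ (w ∷ c ∷ C , wC-clique , wC⊆ , ≤-trans (one-in-D-bound refl) (+-monoˡ-≤ (2 + length C) (s≤s (s≤s z≤n))))
      where open PawFreeSplit noPaw S
    step {v} {B = b ∷ B} {C = []} {D = _ ∷ []} S _ =
      inj₁ (v ∷ b ∷ B , vB-clique , vB⊆ , ≤-trans (one-in-D-bound refl)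
             (≤-trans (≤-reflexive (cong (3 +_) (+-identityʳ _))) (+-monoˡ-≤ (2 + length B) (s≤s (s≤s z≤n)))))
      where open PawFreeSplit noPaw S
    -- R consists of w, b, c, x, so the first case cannot occur; handling it is easier than refuting it.
    step {v} {R = R} {B = _ ∷ []} {C = _ ∷ []} {D = x ∷ []} S _ with length (v ∷ R) ≤? 4
    ... | yes R≤4 with x∈R , vx , _ ← Split.D-class S (here refl) =
      inj₁ (v ∷ x ∷ [] , (vx ∷ []) ∷ [] ∷ [] , here refl ∷ there x∈R ∷ [] , R≤4)
    ... | no R≰4 = inj₂ (≤-antisym (one-in-D-bound refl) (≰⇒> R≰4) , five-cycle (here refl) (here refl) (here refl))
      where open PawFreeSplit noPaw S
    step {B = _ ∷ _ ∷ B} {C = C@(_ ∷ _)} {D = _ ∷ []} S _ =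
      inj₁ (B++C-halfClique (here refl) refl (s≤s (s≤s (≤-trans (s≤s z≤n) (m≤n+m (length C) (length B))))))
      where open PawFreeSplit noPaw S
    step {B = _ ∷ []} {C = _ ∷ _ ∷ _} {D = _ ∷ []} S _ =
      inj₁ (B++C-halfClique (here refl) refl (s≤s (s≤s (s≤s z≤n))))
      where open PawFreeSplit noPaw S

m≤k+k⇒⌈m/2⌉≤k : ∀ {m k} → m ≤ k + k → ⌈ m /2⌉ ≤ k
m≤k+k⇒⌈m/2⌉≤k {k = k} m≤2k = ≤-trans (⌈n/2⌉-mono m≤2k) (≤-reflexive (sym (n≡⌈n+n/2⌉ k)))

halfClique⇒immersion : ∀ {n} (G : Graph n) → HalfClique G (allFin n) → ImmersesComplete G ⌈ n /2⌉
halfClique⇒immersion {n} G (K , K-clique , _ , n≤2K) =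
  clique⇒immersion G K-clique (m≤k+k⇒⌈m/2⌉≤k (subst (_≤ length K + length K) (length-tabulate id) n≤2K))

corollary3p3 : (n : ℕ) (G : Graph n) → IndepNumberAtMost2 G →
    (¬ HasInducedSubgraph G P4) ⊎ (¬ HasInducedSubgraph G K3e) →
    ImmersesComplete G ⌈ n /2⌉
corollary3p3 n G α (inj₁ noP4) =
  halfClique⇒immersion G (halfClique-P4-free G α noP4 (allFin n) (Unique.allFin⁺ n))
corollary3p3 n G α (inj₂ noPaw) with halfCliqueOrC5-paw-free G α noPaw (allFin n) (Unique.allFin⁺ n)
... | inj₁ half               = halfClique⇒immersion G half
... | inj₂ (n≡5 , c5 , _) with refl ← trans (sym (length-tabulate {n = n} id)) n≡5 = inducedC5⇒immersion G c5
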